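{- Let $p$ be a prime and let $A$ be an $n \times n$ matrix with integer entries. Let $r = \operatorname{rank}(A)$ be its rank over $\mathbb{Z}$ and $r_0 = \operatorname{rank}_p(A)$ its rank over $\mathbb{Z}/p\mathbb{Z}$, and assume $n > p^{r_0}$. Then (i) $\operatorname{rank}(A \operatorname{rem} p) \le \dfrac{(p^{r_0} - 1)(p + 1)}{2(p-1)}$; (ii) $\operatorname{rank}(A \operatorname{quo} p) \le r + \dfrac{(p^{r_0} - 1)(p + 1)}{2(p-1)}$.
   Context: For an integer $m$ and a prime $p$, $m \operatorname{rem} p$ and $m \operatorname{quo} p$ denote the remainder and quotient in the Euclidean division $m = qp + s$ with $0 \le s < p$ (so $m \operatorname{rem} p = s$, $m \operatorname{quo} p = q$). These operations are applied entrywise to integer matrices. $\operatorname{rank}(X)$ denotes the rank of an integer matrix $X$ over $\mathbb{Z}$ (equivalently over $\mathbb{Q}$), and $\operatorname{rank}_p(X)$ denotes the rank of the image of $X$ over the field $\mathbb{Z}/p\mathbb{Z}$. -}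

module Defs where

open import Data.Nat as ℕ using (ℕ; zero; suc)
open import Data.Nat.Primality using (Prime; prime⇒nonZero)
open import Data.Fin using (Fin)
open import Data.Integer as ℤ using (ℤ; +_; _/ℕ_; _%ℕ_)
import Data.Integer.Divisibility as ℤD
open import Data.Rational as ℚ using (ℚ)
open import Data.Product using (Σ; _×_)
open import Relation.Binary.PropositionalEquality using (_≡_)
open import Relation.Nullary using (¬_)

-- n × n integer matrices, entries indexed (row, column)
Mat : ℕ → Set
Mat n = Fin n → Fin n → ℤ

sumℚ : (k : ℕ) → (Fin k → ℚ) → ℚ
sumℚ zero    f = ℚ.0ℚ
sumℚ (suc k) f = f Fin.zero ℚ.+ sumℚ k (λ i → f (Fin.suc i))
  where import Data.Fin as Fin

sumℤ : (k : ℕ) → (Fin k → ℤ) → ℤ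
sumℤ zero    f = + 0
sumℤ (suc k) f = f Fin.zero ℤ.+ sumℤ k (λ i → f (Fin.suc i))
  where import Data.Fin as Fin

toℚ : ℤ → ℚ
toℚ z = z ℚ./ 1

IndependentRowsℚ : {n k : ℕ} → Mat n → (Fin k → Fin n) → Set
IndependentRowsℚ {n} {k} A f =
  (c : Fin k → ℚ) →
  ((j : Fin n) → sumℚ k (λ i → c i ℚ.* toℚ (A (f i) j)) ≡ ℚ.0ℚ) →
  (i : Fin k) → c i ≡ ℚ.0ℚ

-- rank over ℤ (= over ℚ): maximal number of linearly independent rows
IsRank : {n : ℕ} → Mat n → ℕ → Set
IsRank {n} A r =
  Σ (Fin r → Fin n) (λ f → IndependentRowsℚ A f) ×
  ((g : Fin (suc r) → Fin n) → ¬ IndependentRowsℚ A g)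

-- Linear independence over ℤ/pℤ of the images of the selected rows.
-- Elements of ℤ/pℤ are represented by integer lifts; equality in ℤ/pℤ
-- is divisibility by p.
IndependentRowsₚ : {n k : ℕ} → ℕ → Mat n → (Fin k → Fin n) → Set
IndependentRowsₚ {n} {k} p A f =
  (c : Fin k → ℤ) →
  ((j : Fin n) → (+ p) ℤD.∣ sumℤ k (λ i → c i ℤ.* A (f i) j)) →
  (i : Fin k) → (+ p) ℤD.∣ c i

IsRankₚ : {n : ℕ} → ℕ → Mat n → ℕ → Set
IsRankₚ {n} p A r =
  Σ (Fin r → Fin n) (λ f → IndependentRowsₚ p A f) ×
  ((g : Fin (suc r) → Fin n) → ¬ IndependentRowsₚ p A g)

-- entrywise Euclidean remainder and quotient (0 ≤ rem < p, floor quotient)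
remM : {n p : ℕ} → Prime p → Mat n → Mat n
remM {p = p} pp A i j = + (A i j %ℕ p)
  where instance _ = prime⇒nonZero pp

quoM : {n p : ℕ} → Prime p → Mat n → Mat n
quoM {p = p} pp A i j = A i j /ℕ p
  where instance _ = prime⇒nonZero pp

-- Modulo p every row of A is an integer combination of r₀ basis rows b₀ … b_{r₀-1}, so a row
-- of A rem p is rem(Σ eₖ bₖ). Dividing by the first coefficient eᵢ ≢ 0 (mod p) writes this as
-- rem(a · u) with 0 < a < p and u = bᵢ + Σ_{k>i} vₖ bₖ, 0 ≤ vₖ < p. Since
-- rem(a u) + rem((p - a) u) = p · [u ≢ 0 mod p] entrywise, rem(a u) lies in the ℚ-span of the
-- vectors rem(c u), 1 ≤ c ≤ (p-1)/2, and [u ≢ 0 mod p]. There are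
-- ((p-1)/2 + 1)(1 + p + … + p^{r₀-1}) ≤ (p^{r₀} - 1)(p + 1) / (2(p - 1)) such vectors, which
-- bounds rank(A rem p) by the exchange lemma; A quo p = (A - A rem p)/p adds at most rank A.

module Submission where

open import Defs
open import Data.Nat using (ℕ; _+_; _*_; _∸_; _^_; _≤_; _<_)
open import Data.Nat.Primality using (Prime)
open import Data.Product using (_×_)

open import Data.Nat using (zero; suc; s≤s; NonZero)
import Data.Nat as ℕ
import Data.Nat.Properties as ℕP
open import Data.Nat.Primality using (prime⇒nonZero; euclidsLemma)
import Data.Nat.Divisibility as ℕD
import Data.Nat.DivMod as ℕDM
import Data.Nat.Coprimality as ℕC
import Data.Nat.GCD as ℕGCD
import Data.Nat.Solver as ℕSolver
open import Data.Integer as ℤ using (ℤ; +_; _%ℕ_; _/ℕ_)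
import Data.Integer.Properties as ℤP
import Data.Integer.DivMod as ℤDM
import Data.Integer.Divisibility.Signed as ℤS
import Data.Integer.GCD as ℤGCD
import Data.Integer.Solver as ℤSolver
open import Data.Rational as ℚ using (ℚ; mkℚ; ↥_; ↧_; ↧ₙ_; 0ℚ; 1ℚ)
import Data.Rational.Properties as ℚP
import Data.Rational.Solver as ℚSolver
open import Data.Fin as Fin using (Fin; punchIn)
import Data.Fin.Properties as FinP
open import Data.Vec as V using (Vec)
import Data.Vec.Properties as VecP
open import Data.Vec.Functional using (insertAt) renaming (_∷_ to _∷ᶠ_)
open import Data.Vec.Functional.Properties using (insertAt-lookup; insertAt-punchIn)
open import Data.List using (List; []; _∷_; _++_; length; lookup; tabulate; map; upTo; cartesianProductWith)
import Data.List.Properties as ListP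
open import Data.List.Membership.Propositional using (_∈_)
open import Data.List.Membership.Propositional.Properties using (∈-map⁺; ∈-upTo⁺)
open import Data.List.Relation.Unary.Any using (here; there)
import Data.List.Relation.Unary.Any.Properties as AnyP
open import Data.Product using (Σ; ∃; _,_; proj₁; proj₂)
open import Data.Sum using (_⊎_; inj₁; inj₂)
open import Data.Empty using (⊥-elim)
open import Relation.Nullary using (¬_; yes; no; ¬?)
open import Relation.Nullary.Decidable using (decidable-stable)
open import Relation.Nullary.Negation using (¬¬-map)
open import Level using (0ℓ)
open import Relation.Binary.Bundles using (Setoid)
open import Relation.Binary.PropositionalEquality
open import Function using (_∘_; _⟨_⟩_)

open ℚSolver.+-*-Solver using (solve; _:=_; _:+_; _:*_; _:-_; :-_; con)
open ℤSolver.+-*-Solver using ()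
  renaming (solve to ℤsolve; _:=_ to _:=ℤ_; _:+_ to _:+ℤ_; _:*_ to _:*ℤ_; _:-_ to _:-ℤ_; :-_ to :-ℤ_; con to conℤ)
open ℕSolver.+-*-Solver using ()
  renaming (solve to ℕsolve; _:=_ to _:=ℕ_; _:+_ to _:+ℕ_; _:*_ to _:*ℕ_; con to conℕ)

↥-toℚ : ∀ z → ↥ toℚ z ≡ z
↥-toℚ z = begin
  ↥ toℚ z                             ≡⟨ sym (ℤP.*-identityʳ _) ⟩
  ↥ toℚ z ℤ.* + 1                     ≡⟨ cong (↥ toℚ z ℤ.*_) (sym (ℤGCD.gcd-zeroʳ z)) ⟩
  ↥ toℚ z ℤ.* ℤGCD.gcd z (+ 1)        ≡⟨ ℚP.↥-/ z 1 ⟩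
  z                                   ∎
  where open ≡-Reasoning

↧ₙ-toℚ : ∀ z → ↧ₙ toℚ z ≡ 1
↧ₙ-toℚ z = ℤP.+-injective (begin
  ↧ toℚ z                             ≡⟨ sym (ℤP.*-identityʳ _) ⟩
  ↧ toℚ z ℤ.* + 1                     ≡⟨ cong (↧ toℚ z ℤ.*_) (sym (ℤGCD.gcd-zeroʳ z)) ⟩
  ↧ toℚ z ℤ.* ℤGCD.gcd z (+ 1)        ≡⟨ ℚP.↧-/ z 1 ⟩
  + 1                                 ∎)
  where open ≡-Reasoning

toℚ-injective : ∀ {a b} → toℚ a ≡ toℚ b → a ≡ b
toℚ-injective {a} {b} eq = trans (sym (↥-toℚ a)) (trans (cong ↥_ eq) (↥-toℚ b))

toℚ-+ : ∀ a b → toℚ (a ℤ.+ b) ≡ toℚ a ℚ.+ toℚ b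
toℚ-+ a b = sym (trans (+-unfold (toℚ a) (toℚ b))
  (ℚP./-cong (cong₂ ℤ._+_ (cross a b) (cross b a)) (cong₂ ℕ._*_ (↧ₙ-toℚ a) (↧ₙ-toℚ b))))
  where
  +-unfold : ∀ x y → x ℚ.+ y ≡ (↥ x ℤ.* ↧ y ℤ.+ ↥ y ℤ.* ↧ x) ℚ./ (↧ₙ x ℕ.* ↧ₙ y)
  +-unfold (mkℚ _ _ _) (mkℚ _ _ _) = refl
  cross : ∀ x y → ↥ toℚ x ℤ.* ↧ toℚ y ≡ x
  cross x y = trans (cong₂ ℤ._*_ (↥-toℚ x) (cong +_ (↧ₙ-toℚ y))) (ℤP.*-identityʳ x)

toℚ-* : ∀ a b → toℚ (a ℤ.* b) ≡ toℚ a ℚ.* toℚ b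
toℚ-* a b = sym (trans (*-unfold (toℚ a) (toℚ b))
  (ℚP./-cong (cong₂ ℤ._*_ (↥-toℚ a) (↥-toℚ b)) (cong₂ ℕ._*_ (↧ₙ-toℚ a) (↧ₙ-toℚ b))))
  where
  *-unfold : ∀ x y → x ℚ.* y ≡ (↥ x ℤ.* ↥ y) ℚ./ (↧ₙ x ℕ.* ↧ₙ y)
  *-unfold (mkℚ _ _ _) (mkℚ _ _ _) = refl

sumℚ-cong : ∀ k {f g : Fin k → ℚ} → (∀ i → f i ≡ g i) → sumℚ k f ≡ sumℚ k g
sumℚ-cong zero    eq = refl
sumℚ-cong (suc k) eq = cong₂ ℚ._+_ (eq Fin.zero) (sumℚ-cong k (eq ∘ Fin.suc))

sumℚ-zero : ∀ k {f : Fin k → ℚ} → (∀ i → f i ≡ 0ℚ) → sumℚ k f ≡ 0ℚ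
sumℚ-zero zero    eq = refl
sumℚ-zero (suc k) eq = trans (cong₂ ℚ._+_ (eq Fin.zero) (sumℚ-zero k (eq ∘ Fin.suc))) (ℚP.+-identityˡ 0ℚ)

sumℚ-+ : ∀ k (f g : Fin k → ℚ) → sumℚ k (λ i → f i ℚ.+ g i) ≡ sumℚ k f ℚ.+ sumℚ k g
sumℚ-+ zero    f g = refl
sumℚ-+ (suc k) f g = trans (cong (f Fin.zero ℚ.+ g Fin.zero ℚ.+_) (sumℚ-+ k (f ∘ Fin.suc) (g ∘ Fin.suc)))
  (solve 4 (λ a b c d → a :+ b :+ (c :+ d) := a :+ c :+ (b :+ d)) refl
    (f Fin.zero) (g Fin.zero) (sumℚ k (f ∘ Fin.suc)) (sumℚ k (g ∘ Fin.suc)))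

sumℚ-*ˡ : ∀ k x (f : Fin k → ℚ) → sumℚ k (λ i → x ℚ.* f i) ≡ x ℚ.* sumℚ k f
sumℚ-*ˡ zero    x f = sym (ℚP.*-zeroʳ x)
sumℚ-*ˡ (suc k) x f = trans (cong (x ℚ.* f Fin.zero ℚ.+_) (sumℚ-*ˡ k x (f ∘ Fin.suc)))
  (sym (ℚP.*-distribˡ-+ x (f Fin.zero) (sumℚ k (f ∘ Fin.suc))))

sumℚ-swap : ∀ k m (f : Fin k → Fin m → ℚ) →
  sumℚ k (λ i → sumℚ m (f i)) ≡ sumℚ m (λ l → sumℚ k (λ i → f i l))
sumℚ-swap zero    m f = sym (sumℚ-zero m (λ _ → refl))
sumℚ-swap (suc k) m f = trans (cong (sumℚ m (f Fin.zero) ℚ.+_) (sumℚ-swap k m (f ∘ Fin.suc)))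
  (sym (sumℚ-+ m (f Fin.zero) (λ l → sumℚ k (λ i → f (Fin.suc i) l))))

sumℚ-punchIn : ∀ s (f : Fin (suc s) → ℚ) i → sumℚ (suc s) f ≡ f i ℚ.+ sumℚ s (f ∘ punchIn i)
sumℚ-punchIn s       f Fin.zero    = refl
sumℚ-punchIn (suc s) f (Fin.suc i) =
  trans (cong (f Fin.zero ℚ.+_) (sumℚ-punchIn s (f ∘ Fin.suc) i))
    (solve 3 (λ a b c → a :+ (b :+ c) := b :+ (a :+ c)) refl
      (f Fin.zero) (f (Fin.suc i)) (sumℚ s (f ∘ Fin.suc ∘ punchIn i)))

sumℤ-*ˡ : ∀ k x (f : Fin k → ℤ) → sumℤ k (λ i → x ℤ.* f i) ≡ x ℤ.* sumℤ k f
sumℤ-*ˡ zero    x f = sym (ℤP.*-zeroʳ x)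
sumℤ-*ˡ (suc k) x f = trans (cong (ℤ._+_ (x ℤ.* f Fin.zero)) (sumℤ-*ˡ k x (f ∘ Fin.suc)))
  (sym (ℤP.*-distribˡ-+ x (f Fin.zero) (sumℤ k (f ∘ Fin.suc))))

Independent : ∀ {n} s → (Fin s → Fin n → ℚ) → Set
Independent {n} s v =
  (c : Fin s → ℚ) → (∀ j → sumℚ s (λ i → c i ℚ.* v i j) ≡ 0ℚ) → ∀ i → c i ≡ 0ℚ

Dependent : ∀ {n} s → (Fin s → Fin n → ℚ) → Set
Dependent {n} s v =
  Σ (Fin s → ℚ) λ c → (∃ λ i → ¬ c i ≡ 0ℚ) × (∀ j → sumℚ s (λ i → c i ℚ.* v i j) ≡ 0ℚ)

dependent⇒¬independent : ∀ {n s} {v : Fin s → Fin n → ℚ} → Dependent s v → ¬ Independent s v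
dependent⇒¬independent (c , (i , cᵢ≢0) , rel) ind = cᵢ≢0 (ind c rel i)

p*q≡0⇒q≡0 : ∀ p q → ¬ p ≡ 0ℚ → p ℚ.* q ≡ 0ℚ → q ≡ 0ℚ
p*q≡0⇒q≡0 p q p≢0 pq≡0 = begin
  q                       ≡⟨ sym (ℚP.*-identityˡ q) ⟩
  1ℚ ℚ.* q                ≡⟨ cong (ℚ._* q) (sym (ℚP.*-inverseˡ p)) ⟩
  (ℚ.1/ p ℚ.* p) ℚ.* q    ≡⟨ ℚP.*-assoc (ℚ.1/ p) p q ⟩
  ℚ.1/ p ℚ.* (p ℚ.* q)    ≡⟨ cong (ℚ.1/ p ℚ.*_) pq≡0 ⟩
  ℚ.1/ p ℚ.* 0ℚ           ≡⟨ ℚP.*-zeroʳ (ℚ.1/ p) ⟩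
  0ℚ                      ∎
  where
  open ≡-Reasoning
  instance _ = ℚ.≢-nonZero p≢0

dependent-tail⇒dependent : ∀ {N s} (v : Fin s → Fin (suc N) → ℚ) → (∀ i → v i Fin.zero ≡ 0ℚ) →
  Dependent s (λ i l → v i (Fin.suc l)) → Dependent s v
dependent-tail⇒dependent v head≡0 (c , nontrivial , rel) = c , nontrivial , λ
  { Fin.zero    → sumℚ-zero _ (λ i → trans (cong (c i ℚ.*_) (head≡0 i)) (ℚP.*-zeroʳ (c i)))
  ; (Fin.suc l) → rel l }

eliminate : ∀ {N s} (v : Fin (suc s) → Fin (suc N) → ℚ) → Fin (suc s) → Fin s → Fin N → ℚ
eliminate v i k l =
  v i Fin.zero ℚ.* v (punchIn i k) (Fin.suc l) ℚ.- v (punchIn i k) Fin.zero ℚ.* v i (Fin.suc l)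

dependent-eliminate⇒dependent : ∀ {N s} (v : Fin (suc s) → Fin (suc N) → ℚ) i → ¬ v i Fin.zero ≡ 0ℚ →
  Dependent s (eliminate v i) → Dependent (suc s) v
dependent-eliminate⇒dependent {s = s} v i a≢0 (c , (k , cₖ≢0) , rel) =
  c⁺ , (punchIn i k , c⁺ₖ≢0) , λ { Fin.zero → rel-head ; (Fin.suc l) → rel-tail l }
  where
  open ≡-Reasoning
  a S : ℚ
  a = v i Fin.zero
  S = sumℚ s (λ k → c k ℚ.* v (punchIn i k) Fin.zero)
  ac : Fin s → ℚ
  ac k = a ℚ.* c k
  c⁺ : Fin (suc s) → ℚ
  c⁺ = insertAt ac i (ℚ.- S)
  c⁺ₖ≢0 : ¬ c⁺ (punchIn i k) ≡ 0ℚ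
  c⁺ₖ≢0 eq = cₖ≢0 (p*q≡0⇒q≡0 a (c k) a≢0 (trans (sym (insertAt-punchIn ac i (ℚ.- S) k)) eq))
  split : ∀ l → sumℚ (suc s) (λ j → c⁺ j ℚ.* v j l)
              ≡ ℚ.- S ℚ.* v i l ℚ.+ a ℚ.* sumℚ s (λ k → c k ℚ.* v (punchIn i k) l)
  split l = trans (sumℚ-punchIn s (λ j → c⁺ j ℚ.* v j l) i) (cong₂ ℚ._+_
    (cong (ℚ._* v i l) (insertAt-lookup ac i (ℚ.- S)))
    (trans (sumℚ-cong s (λ k → trans (cong (ℚ._* v (punchIn i k) l) (insertAt-punchIn ac i (ℚ.- S) k))
                                     (ℚP.*-assoc a (c k) (v (punchIn i k) l))))
           (sumℚ-*ˡ s a (λ k → c k ℚ.* v (punchIn i k) l))))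
  rel-head : sumℚ (suc s) (λ j → c⁺ j ℚ.* v j Fin.zero) ≡ 0ℚ
  rel-head = trans (split Fin.zero) (solve 2 (λ S a → (:- S) :* a :+ a :* S := con 0ℚ) refl S a)
  rel-tail : ∀ l → sumℚ (suc s) (λ j → c⁺ j ℚ.* v j (Fin.suc l)) ≡ 0ℚ
  rel-tail l = begin
    sumℚ (suc s) (λ j → c⁺ j ℚ.* v j (Fin.suc l))   ≡⟨ split (Fin.suc l) ⟩
    ℚ.- S ℚ.* z ℚ.+ a ℚ.* sumℚ s X
      ≡⟨ solve 3 (λ S z aT → (:- S) :* z :+ aT := aT :+ (:- z) :* S) refl S z (a ℚ.* sumℚ s X) ⟩
    a ℚ.* sumℚ s X ℚ.+ ℚ.- z ℚ.* S                   ≡⟨ cong₂ ℚ._+_ (sym (sumℚ-*ˡ s a X)) (sym (sumℚ-*ˡ s (ℚ.- z) Y)) ⟩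
    sumℚ s (λ k → a ℚ.* X k) ℚ.+ sumℚ s (λ k → ℚ.- z ℚ.* Y k)
                                                    ≡⟨ sym (sumℚ-+ s (λ k → a ℚ.* X k) (λ k → ℚ.- z ℚ.* Y k)) ⟩
    sumℚ s (λ k → a ℚ.* X k ℚ.+ ℚ.- z ℚ.* Y k)
      ≡⟨ sumℚ-cong s (λ k → solve 5 (λ a c x y z → a :* (c :* x) :+ (:- z) :* (c :* y) := c :* (a :* x :- y :* z)) refl
                                  a (c k) (v (punchIn i k) (Fin.suc l)) (v (punchIn i k) Fin.zero) z) ⟩
    sumℚ s (λ k → c k ℚ.* eliminate v i k l)        ≡⟨ rel l ⟩
    0ℚ                                              ∎
    where
    z : ℚ
    z = v i (Fin.suc l)
    X Y : Fin s → ℚ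
    X k = c k ℚ.* v (punchIn i k) (Fin.suc l)
    Y k = c k ℚ.* v (punchIn i k) Fin.zero

dimension<count⇒dependent : ∀ {N s} → N < s → (v : Fin s → Fin N → ℚ) → Dependent s v
dimension<count⇒dependent {zero}  {suc s} _          v = (λ _ → 1ℚ) , (Fin.zero , λ ()) , λ ()
dimension<count⇒dependent {suc N} {suc s} (s≤s N<s) v
  with FinP.any? (λ i → ¬? (v i Fin.zero ℚP.≟ 0ℚ))
... | yes (i , vᵢ₀≢0) = dependent-eliminate⇒dependent v i vᵢ₀≢0 (dimension<count⇒dependent N<s (eliminate v i))
... | no  noPivot     = dependent-tail⇒dependent v
  (λ i → decidable-stable (v i Fin.zero ℚP.≟ 0ℚ) (λ ne → noPivot (i , ne)))
  (dimension<count⇒dependent (ℕP.m<n⇒m<1+n N<s) (λ i l → v i (Fin.suc l)))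

dependent-coefficients⇒dependent : ∀ {n s N} (v : Fin s → Fin n → ℚ) (w : Fin N → Fin n → ℚ) (α : Fin s → Fin N → ℚ) →
  (∀ i j → v i j ≡ sumℚ N (λ l → α i l ℚ.* w l j)) → Dependent s α → Dependent s v
dependent-coefficients⇒dependent {s = s} {N} v w α v≡αw (c , nontrivial , rel) = c , nontrivial , λ j → begin
  sumℚ s (λ i → c i ℚ.* v i j)
    ≡⟨ sumℚ-cong s (λ i → trans (cong (c i ℚ.*_) (v≡αw i j)) (sym (sumℚ-*ˡ N (c i) (λ l → α i l ℚ.* w l j)))) ⟩
  sumℚ s (λ i → sumℚ N (λ l → c i ℚ.* (α i l ℚ.* w l j)))
    ≡⟨ sumℚ-swap s N (λ i l → c i ℚ.* (α i l ℚ.* w l j)) ⟩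
  sumℚ N (λ l → sumℚ s (λ i → c i ℚ.* (α i l ℚ.* w l j)))
    ≡⟨ sumℚ-cong N (λ l → trans (sumℚ-cong s (λ i → solve 3 (λ c a w → c :* (a :* w) := w :* (c :* a)) refl (c i) (α i l) (w l j)))
                                (sumℚ-*ˡ s (w l j) (λ i → c i ℚ.* α i l))) ⟩
  sumℚ N (λ l → w l j ℚ.* sumℚ s (λ i → c i ℚ.* α i l))
    ≡⟨ sumℚ-zero N (λ l → trans (cong (w l j ℚ.*_) (rel l)) (ℚP.*-zeroʳ (w l j))) ⟩
  0ℚ                                                           ∎
  where open ≡-Reasoning

independent-combinations⇒≤ : ∀ {n s N} (v : Fin s → Fin n → ℚ) (w : Fin N → Fin n → ℚ) (α : Fin s → Fin N → ℚ) →
  (∀ i j → v i j ≡ sumℚ N (λ l → α i l ℚ.* w l j)) → Independent s v → s ≤ N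
independent-combinations⇒≤ {s = s} {N} v w α v≡αw ind with s ℕP.≤? N
... | yes s≤N = s≤N
... | no  s≰N = ⊥-elim (dependent⇒¬independent
  (dependent-coefficients⇒dependent v w α v≡αw (dimension<count⇒dependent (ℕP.≰⇒> s≰N) α)) ind)

relation⇒combination : ∀ {n r} (v : Fin (suc r) → Fin n → ℚ) (c : Fin (suc r) → ℚ) → ¬ c Fin.zero ≡ 0ℚ →
  (∀ j → sumℚ (suc r) (λ i → c i ℚ.* v i j) ≡ 0ℚ) →
  Σ (Fin r → ℚ) λ α → ∀ j → v Fin.zero j ≡ sumℚ r (λ k → α k ℚ.* v (Fin.suc k) j)
relation⇒combination {n} {r} v c c₀≢0 rel = (λ k → ℚ.- c₀⁻¹ ℚ.* c (Fin.suc k)) , λ j → sym (begin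
  sumℚ r (λ k → ℚ.- c₀⁻¹ ℚ.* c (Fin.suc k) ℚ.* v (Fin.suc k) j)
    ≡⟨ trans (sumℚ-cong r (λ k → ℚP.*-assoc (ℚ.- c₀⁻¹) (c (Fin.suc k)) (v (Fin.suc k) j)))
             (sumℚ-*ˡ r (ℚ.- c₀⁻¹) (λ k → c (Fin.suc k) ℚ.* v (Fin.suc k) j)) ⟩
  ℚ.- c₀⁻¹ ℚ.* R j                          ≡⟨ solve 4 (λ i c₀ x R → (:- i) :* R := (i :* c₀) :* x :- i :* (c₀ :* x :+ R)) refl
                                                  c₀⁻¹ (c Fin.zero) (v Fin.zero j) (R j) ⟩
  (c₀⁻¹ ℚ.* c Fin.zero) ℚ.* v Fin.zero j ℚ.- c₀⁻¹ ℚ.* (c Fin.zero ℚ.* v Fin.zero j ℚ.+ R j)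
    ≡⟨ cong₂ (λ y z → y ℚ.* v Fin.zero j ℚ.- c₀⁻¹ ℚ.* z) (ℚP.*-inverseˡ (c Fin.zero)) (rel j) ⟩
  1ℚ ℚ.* v Fin.zero j ℚ.- c₀⁻¹ ℚ.* 0ℚ      ≡⟨ solve 2 (λ x i → con 1ℚ :* x :- i :* con 0ℚ := x) refl (v Fin.zero j) c₀⁻¹ ⟩
  v Fin.zero j                              ∎)
  where
  open ≡-Reasoning
  instance _ = ℚ.≢-nonZero c₀≢0
  c₀⁻¹ : ℚ
  c₀⁻¹ = ℚ.1/ c Fin.zero
  R : Fin n → ℚ
  R j = sumℚ r (λ k → c (Fin.suc k) ℚ.* v (Fin.suc k) j)

Span : ∀ {n} → List (Fin n → ℚ) → (Fin n → ℚ) → Set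
Span []      v = ∀ j → v j ≡ 0ℚ
Span (x ∷ L) v = Σ ℚ λ k → Span L (λ j → v j ℚ.- k ℚ.* x j)

Span-resp : ∀ {n} (L : List (Fin n → ℚ)) {u v} → (∀ j → u j ≡ v j) → Span L u → Span L v
Span-resp []      u≡v sp          j = trans (sym (u≡v j)) (sp j)
Span-resp (x ∷ L) u≡v (k , sp)      = k , Span-resp L (λ j → cong (ℚ._- k ℚ.* x j) (u≡v j)) sp

private
  x-0*y≡x : ∀ x y → x ≡ x ℚ.- 0ℚ ℚ.* y
  x-0*y≡x = solve 2 (λ x y → x := x :- con 0ℚ :* y) refl

Span-zero : ∀ {n} (L : List (Fin n → ℚ)) {v} → (∀ j → v j ≡ 0ℚ) → Span L v
Span-zero []      v≡0 = v≡0
Span-zero (x ∷ L) v≡0 = 0ℚ , Span-zero L (λ j → trans (cong (ℚ._- 0ℚ ℚ.* x j) (v≡0 j)) (sym (x-0*y≡x 0ℚ (x j))))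

Span-linear : ∀ {n} (L : List (Fin n → ℚ)) a b {u v} → Span L u → Span L v →
  Span L (λ j → a ℚ.* u j ℚ.+ b ℚ.* v j)
Span-linear []      a b sp₁ sp₂ j = trans (cong₂ (λ x y → a ℚ.* x ℚ.+ b ℚ.* y) (sp₁ j) (sp₂ j))
  (solve 2 (λ a b → a :* con 0ℚ :+ b :* con 0ℚ := con 0ℚ) refl a b)
Span-linear (x ∷ L) a b {u} {v} (k₁ , sp₁) (k₂ , sp₂) = a ℚ.* k₁ ℚ.+ b ℚ.* k₂ ,
  Span-resp L (λ j → solve 7 (λ a b u v k₁ k₂ x → a :* (u :- k₁ :* x) :+ b :* (v :- k₂ :* x)
                                             := a :* u :+ b :* v :- (a :* k₁ :+ b :* k₂) :* x)
                             refl a b (u j) (v j) k₁ k₂ (x j))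
    (Span-linear L a b sp₁ sp₂)

Span-∈ : ∀ {n} (L : List (Fin n → ℚ)) {x} → x ∈ L → Span L x
Span-∈ (x ∷ L) (here refl) = 1ℚ , Span-zero L (λ j → solve 1 (λ y → y :- con 1ℚ :* y := con 0ℚ) refl (x j))
Span-∈ (y ∷ L) (there x∈L) = 0ℚ , Span-resp L (λ j → x-0*y≡x _ (y j)) (Span-∈ L x∈L)

Span-++⁺ˡ : ∀ {n} (L L′ : List (Fin n → ℚ)) {v} → Span L v → Span (L ++ L′) v
Span-++⁺ˡ []      L′ sp       = Span-zero L′ sp
Span-++⁺ˡ (x ∷ L) L′ (k , sp) = k , Span-++⁺ˡ L L′ sp

Span-++⁺ʳ : ∀ {n} (L L′ : List (Fin n → ℚ)) {v} → Span L′ v → Span (L ++ L′) v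
Span-++⁺ʳ []      L′ sp = sp
Span-++⁺ʳ (x ∷ L) L′ sp = 0ℚ , Span-++⁺ʳ L L′ (Span-resp L′ (λ j → x-0*y≡x _ (x j)) sp)

Span-tabulate : ∀ {n m} (w : Fin m → Fin n → ℚ) (α : Fin m → ℚ) {v} →
  (∀ j → v j ≡ sumℚ m (λ k → α k ℚ.* w k j)) → Span (tabulate w) v
Span-tabulate {m = zero}  w α v≡αw = v≡αw
Span-tabulate {m = suc m} w α {v} v≡αw = α Fin.zero , Span-tabulate (w ∘ Fin.suc) (α ∘ Fin.suc) (λ j →
  trans (cong (ℚ._- α Fin.zero ℚ.* w Fin.zero j) (v≡αw j))
    (solve 2 (λ x y → x :+ y :- x := y) refl (α Fin.zero ℚ.* w Fin.zero j) (sumℚ m (λ k → α (Fin.suc k) ℚ.* w (Fin.suc k) j))))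

Span⇒combination : ∀ {n} (L : List (Fin n → ℚ)) {v} → Span L v →
  Σ (Fin (length L) → ℚ) λ α → ∀ j → v j ≡ sumℚ (length L) (λ l → α l ℚ.* lookup L l j)
Span⇒combination []      sp       = (λ ()) , sp
Span⇒combination (x ∷ L) {v} (k , sp) with Span⇒combination L sp
... | α , v-kx≡αL = (λ { Fin.zero → k ; (Fin.suc l) → α l }) , λ j →
  trans (solve 3 (λ v k x → v := k :* x :+ (v :- k :* x)) refl (v j) k (x j)) (cong (k ℚ.* x j ℚ.+_) (v-kx≡αL j))

independent-in-Span⇒≤length : ∀ {n s} (L : List (Fin n → ℚ)) (v : Fin s → Fin n → ℚ) →
  (∀ i → Span L (v i)) → Independent s v → s ≤ length L
independent-in-Span⇒≤length L v v∈L = independent-combinations⇒≤ v (lookup L)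
  (λ i → proj₁ (Span⇒combination L (v∈L i))) (λ i → proj₂ (Span⇒combination L (v∈L i)))

¬¬-pull-Fin : ∀ s {P : Fin s → Set} → (∀ i → ¬ ¬ P i) → ¬ ¬ (∀ i → P i)
¬¬-pull-Fin zero    ¬¬P ¬∀P = ¬∀P (λ ())
¬¬-pull-Fin (suc s) ¬¬P ¬∀P = ¬¬P Fin.zero (λ P₀ → ¬¬-pull-Fin s (¬¬P ∘ Fin.suc)
  (λ P₊ → ¬∀P (λ { Fin.zero → P₀ ; (Fin.suc i) → P₊ i })))

-- Maximality of an independent set only yields spanning up to double negation.
independent-in-¬¬Span⇒≤length : ∀ {n s} (L : List (Fin n → ℚ)) (v : Fin s → Fin n → ℚ) →
  (∀ i → ¬ ¬ Span L (v i)) → Independent s v → s ≤ length L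
independent-in-¬¬Span⇒≤length {s = s} L v v∈L ind = decidable-stable (s ℕP.≤? length L)
  (λ s≰ → ¬¬-pull-Fin s v∈L (λ v∈L′ → s≰ (independent-in-Span⇒≤length L v v∈L′ ind)))

maximal-independent⇒combination : ∀ {n r} (A : Mat n) {f : Fin r → Fin n} → IndependentRowsℚ A f →
  ((g : Fin (suc r) → Fin n) → ¬ IndependentRowsℚ A g) →
  ∀ x → ¬ ¬ Σ (Fin r → ℚ) λ α → ∀ j → toℚ (A x j) ≡ sumℚ r (λ k → α k ℚ.* toℚ (A (f k) j))
maximal-independent⇒combination {r = r} A {f} ind maximal x ¬comb = maximal (x ∷ᶠ f) λ c rel →
  let c₀≡0 = decidable-stable (c Fin.zero ℚP.≟ 0ℚ)
               (λ c₀≢0 → ¬comb (relation⇒combination (λ i j → toℚ (A ((x ∷ᶠ f) i) j)) c c₀≢0 rel))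
  in λ { Fin.zero    → c₀≡0
       ; (Fin.suc k) → ind (c ∘ Fin.suc) (λ j → trans
           (sym (trans (cong (ℚ._+ sumℚ r (λ k → c (Fin.suc k) ℚ.* toℚ (A (f k) j)))
                             (trans (cong (ℚ._* toℚ (A x j)) c₀≡0) (ℚP.*-zeroˡ (toℚ (A x j)))))
                       (ℚP.+-identityˡ (sumℚ r (λ k → c (Fin.suc k) ℚ.* toℚ (A (f k) j))))))
           (rel j)) k }

length-cartesianProductWith : ∀ {A B C : Set} (f : A → B → C) xs ys →
  length (cartesianProductWith f xs ys) ≡ length xs * length ys
length-cartesianProductWith f []       ys = refl
length-cartesianProductWith f (x ∷ xs) ys = trans (ListP.length-++ (map (f x) ys))
  (cong₂ _+_ (ListP.length-map (f x) ys) (length-cartesianProductWith f xs ys))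

module Modulo {p : ℕ} (pp : Prime p) where

  instance
    p≢0 : NonZero p
    p≢0 = prime⇒nonZero pp

  -- A record rather than a definition, so that x and y can be inferred from a proof.
  infix 4 _≡ₚ_
  record _≡ₚ_ (x y : ℤ) : Set where
    constructor mkₚ
    field divides : + p ℤS.∣ x ℤ.- y

  ≡ₚ-reflexive : ∀ {x y} → x ≡ y → x ≡ₚ y
  ≡ₚ-reflexive {x} refl = mkₚ (subst (+ p ℤS.∣_) (sym (ℤP.+-inverseʳ x)) (ℤS.divides (+ 0) refl))

  ≡ₚ-sym : ∀ {x y} → x ≡ₚ y → y ≡ₚ x
  ≡ₚ-sym {x} {y} (mkₚ d) = mkₚ (subst (+ p ℤS.∣_) (ℤsolve 2 (λ x y → :-ℤ (x :-ℤ y) :=ℤ y :-ℤ x) refl x y) (ℤS.∣m⇒∣-m d))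

  ≡ₚ-trans : ∀ {x y z} → x ≡ₚ y → y ≡ₚ z → x ≡ₚ z
  ≡ₚ-trans {x} {y} {z} (mkₚ d) (mkₚ e) =
    mkₚ (subst (+ p ℤS.∣_) (ℤsolve 3 (λ x y z → (x :-ℤ y) :+ℤ (y :-ℤ z) :=ℤ x :-ℤ z) refl x y z) (ℤS.∣m∣n⇒∣m+n d e))

  ≡ₚ-setoid : Setoid 0ℓ 0ℓ
  ≡ₚ-setoid = record { Carrier = ℤ ; _≈_ = _≡ₚ_
                     ; isEquivalence = record { refl = ≡ₚ-reflexive refl ; sym = ≡ₚ-sym ; trans = ≡ₚ-trans } }

  +-cong-≡ₚ : ∀ {x y x′ y′} → x ≡ₚ y → x′ ≡ₚ y′ → x ℤ.+ x′ ≡ₚ y ℤ.+ y′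
  +-cong-≡ₚ {x} {y} {x′} {y′} (mkₚ d) (mkₚ e) = mkₚ (subst (+ p ℤS.∣_)
    (ℤsolve 4 (λ x y x′ y′ → (x :-ℤ y) :+ℤ (x′ :-ℤ y′) :=ℤ (x :+ℤ x′) :-ℤ (y :+ℤ y′)) refl x y x′ y′)
    (ℤS.∣m∣n⇒∣m+n d e))

  *-cong-≡ₚ : ∀ {x y x′ y′} → x ≡ₚ y → x′ ≡ₚ y′ → x ℤ.* x′ ≡ₚ y ℤ.* y′
  *-cong-≡ₚ {x} {y} {x′} {y′} (mkₚ d) (mkₚ e) = mkₚ (subst (+ p ℤS.∣_)
    (ℤsolve 4 (λ x y x′ y′ → x :*ℤ (x′ :-ℤ y′) :+ℤ y′ :*ℤ (x :-ℤ y) :=ℤ (x :*ℤ x′) :-ℤ (y :*ℤ y′)) refl x y x′ y′)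
    (ℤS.∣m∣n⇒∣m+n (ℤS.∣n⇒∣m*n x e) (ℤS.∣n⇒∣m*n y′ d)))

  ∣⇒≡ₚ0 : ∀ {x} → + p ℤS.∣ x → x ≡ₚ + 0
  ∣⇒≡ₚ0 {x} d = mkₚ (subst (+ p ℤS.∣_) (sym (ℤP.+-identityʳ x)) d)

  ≡ₚ0⇒∣ : ∀ {x} → x ≡ₚ + 0 → + p ℤS.∣ x
  ≡ₚ0⇒∣ {x} (mkₚ d) = subst (+ p ℤS.∣_) (ℤP.+-identityʳ x) d

  ≡ₚ-%ℕ : ∀ x → x ≡ₚ + (x %ℕ p)
  ≡ₚ-%ℕ x = mkₚ (ℤS.divides (x /ℕ p) (begin
    x ℤ.- + (x %ℕ p)                            ≡⟨ cong (ℤ._- + (x %ℕ p)) (ℤDM.a≡a%ℕn+[a/ℕn]*n x p) ⟩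
    + (x %ℕ p) ℤ.+ (x /ℕ p) ℤ.* + p ℤ.- + (x %ℕ p) ≡⟨ ℤsolve 2 (λ r q → r :+ℤ q :-ℤ r :=ℤ q) refl (+ (x %ℕ p)) ((x /ℕ p) ℤ.* + p) ⟩
    (x /ℕ p) ℤ.* + p                            ∎))
    where open ≡-Reasoning

  ¬∣-small : ∀ {a} → 0 < a → a < p → ¬ + p ℤS.∣ + a
  ¬∣-small {a} 0<a a<p d = ℕP.<-irrefl refl (ℕP.<-≤-trans a<p (ℕD.∣⇒≤ {{ℕ.>-nonZero 0<a}} (ℤS.∣⇒∣ᵤ d)))

  ≡ₚ-small⇒≡ : ∀ {a b} → a < p → b ≤ a → + a ≡ₚ + b → a ≡ b
  ≡ₚ-small⇒≡ {a} {b} a<p b≤a (mkₚ d) with a ∸ b ℕP.≟ 0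
  ... | yes a∸b≡0 = ℕP.≤-antisym (ℕP.m∸n≡0⇒m≤n a∸b≡0) b≤a
  ... | no  a∸b≢0 = ⊥-elim (¬∣-small (ℕP.n≢0⇒n>0 a∸b≢0) (ℕP.≤-<-trans (ℕP.m∸n≤m a b) a<p)
                      (subst (+ p ℤS.∣_) (trans (ℤP.[+m]-[+n]≡m⊖n a b) (ℤP.⊖-≥ b≤a)) d))

  %ℕ-cong : ∀ {x y} → x ≡ₚ y → x %ℕ p ≡ y %ℕ p
  %ℕ-cong {x} {y} x≡y with ℕP.≤-total (x %ℕ p) (y %ℕ p)
  ... | inj₁ x%≤y% = sym (≡ₚ-small⇒≡ (ℤDM.n%ℕd<d y p) x%≤y% (≡ₚ-trans (≡ₚ-sym (≡ₚ-%ℕ y)) (≡ₚ-trans (≡ₚ-sym x≡y) (≡ₚ-%ℕ x))))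
  ... | inj₂ y%≤x% = ≡ₚ-small⇒≡ (ℤDM.n%ℕd<d x p) y%≤x% (≡ₚ-trans (≡ₚ-sym (≡ₚ-%ℕ x)) (≡ₚ-trans x≡y (≡ₚ-%ℕ y)))

  ∣⇒%ℕ≡0 : ∀ {x} → + p ℤS.∣ x → x %ℕ p ≡ 0
  ∣⇒%ℕ≡0 d = trans (%ℕ-cong (∣⇒≡ₚ0 d)) (ℕDM.m*n%n≡0 0 p)

  ¬∣⇒%ℕ>0 : ∀ {x} → ¬ + p ℤS.∣ x → 0 < x %ℕ p
  ¬∣⇒%ℕ>0 {x} ¬d with x %ℕ p ℕP.≟ 0
  ... | yes x%p≡0 = ⊥-elim (¬d (≡ₚ0⇒∣ (≡ₚ-trans (≡ₚ-%ℕ x) (≡ₚ-reflexive (cong +_ x%p≡0)))))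
  ... | no  x%p≢0 = ℕP.n≢0⇒n>0 x%p≢0

  ∣-*⇒∣ : ∀ a b → + p ℤS.∣ a ℤ.* b → + p ℤS.∣ a ⊎ + p ℤS.∣ b
  ∣-*⇒∣ a b d with euclidsLemma ℤ.∣ a ∣ ℤ.∣ b ∣ pp (subst (p ℕD.∣_) (ℤP.abs-* a b) (ℤS.∣⇒∣ᵤ d))
  ... | inj₁ p∣a = inj₁ (ℤS.∣ᵤ⇒∣ p∣a)
  ... | inj₂ p∣b = inj₂ (ℤS.∣ᵤ⇒∣ p∣b)

  inverseₚ-small : ∀ {m} → 0 < m → m < p → Σ ℤ λ d → d ℤ.* + m ≡ₚ + 1
  inverseₚ-small {m} 0<m m<p with ℕC.coprime-Bézout (ℕC.prime⇒coprime pp {{ℕ.>-nonZero 0<m}} m<p)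
  ... | ℕGCD.Bézout.+- x y 1+ym≡xp = ℤ.- + y , mkₚ (ℤS.divides (ℤ.- + x) (begin
    ℤ.- + y ℤ.* + m ℤ.- + 1    ≡⟨ ℤsolve 2 (λ y m → :-ℤ y :*ℤ m :-ℤ conℤ (+ 1) :=ℤ :-ℤ (conℤ (+ 1) :+ℤ y :*ℤ m)) refl (+ y) (+ m) ⟩
    ℤ.- (+ 1 ℤ.+ + y ℤ.* + m)  ≡⟨ cong ℤ.-_ (cong (ℤ._+_ (+ 1)) (sym (ℤP.pos-* y m)) ⟨ trans ⟩ sym (ℤP.pos-+ 1 (y ℕ.* m))) ⟩
    ℤ.- (+ (1 ℕ.+ y ℕ.* m))    ≡⟨ cong (λ z → ℤ.- + z) 1+ym≡xp ⟩
    ℤ.- (+ (x ℕ.* p))          ≡⟨ cong ℤ.-_ (ℤP.pos-* x p) ⟨ trans ⟩ ℤP.neg-distribˡ-* (+ x) (+ p) ⟩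
    ℤ.- + x ℤ.* + p            ∎))
    where open ≡-Reasoning
  ... | ℕGCD.Bézout.-+ x y 1+xp≡ym = + y , mkₚ (ℤS.divides (+ x) (begin
    + y ℤ.* + m ℤ.- + 1        ≡⟨ cong (ℤ._- + 1) (sym (ℤP.pos-* y m) ⟨ trans ⟩ cong +_ (sym 1+xp≡ym)) ⟩
    + (1 ℕ.+ x ℕ.* p) ℤ.- + 1  ≡⟨ ℤsolve 1 (λ z → conℤ (+ 1) :+ℤ z :-ℤ conℤ (+ 1) :=ℤ z) refl (+ (x ℕ.* p)) ⟩
    + (x ℕ.* p)                ≡⟨ ℤP.pos-* x p ⟩
    + x ℤ.* + p                ∎))
    where open ≡-Reasoning

  inverseₚ : ∀ a → ¬ + p ℤS.∣ a → Σ ℤ λ d → d ℤ.* a ≡ₚ + 1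
  inverseₚ a ¬p∣a with inverseₚ-small (¬∣⇒%ℕ>0 ¬p∣a) (ℤDM.n%ℕd<d a p)
  ... | d , dm≡1 = d , ≡ₚ-trans (*-cong-≡ₚ (≡ₚ-reflexive {d} refl) (≡ₚ-%ℕ a)) dm≡1

  sumℤ-cong-≡ₚ : ∀ k {f g : Fin k → ℤ} → (∀ i → f i ≡ₚ g i) → sumℤ k f ≡ₚ sumℤ k g
  sumℤ-cong-≡ₚ zero    eq = ≡ₚ-reflexive refl
  sumℤ-cong-≡ₚ (suc k) eq = +-cong-≡ₚ (eq Fin.zero) (sumℤ-cong-≡ₚ k (eq ∘ Fin.suc))

  relationₚ⇒combination : ∀ {n r} (v : Fin (suc r) → Fin n → ℤ) (c : Fin (suc r) → ℤ) → ¬ + p ℤS.∣ c Fin.zero →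
    (∀ j → + p ℤS.∣ sumℤ (suc r) (λ i → c i ℤ.* v i j)) →
    Σ (Fin r → ℤ) λ e → ∀ j → v Fin.zero j ≡ₚ sumℤ r (λ k → e k ℤ.* v (Fin.suc k) j)
  relationₚ⇒combination {n} {r} v c ¬p∣c₀ rel = (λ k → ℤ.- d ℤ.* c (Fin.suc k)) , λ j → begin
    v Fin.zero j                                    ≡⟨ sym (ℤP.*-identityˡ (v Fin.zero j)) ⟩
    + 1 ℤ.* v Fin.zero j                            ≈⟨ *-cong-≡ₚ (≡ₚ-sym dc₀≡1) (≡ₚ-reflexive refl) ⟩
    d ℤ.* c Fin.zero ℤ.* v Fin.zero j               ≡⟨ ℤsolve 4 (λ d c₀ x R → d :*ℤ c₀ :*ℤ x :=ℤ d :*ℤ (c₀ :*ℤ x :+ℤ R) :+ℤ (:-ℤ d) :*ℤ R)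
                                                          refl d (c Fin.zero) (v Fin.zero j) (R j) ⟩
    d ℤ.* sumℤ (suc r) (λ i → c i ℤ.* v i j) ℤ.+ ℤ.- d ℤ.* R j
                                                    ≈⟨ +-cong-≡ₚ (∣⇒≡ₚ0 (ℤS.∣n⇒∣m*n d (rel j))) (≡ₚ-reflexive refl) ⟩
    + 0 ℤ.+ ℤ.- d ℤ.* R j                           ≡⟨ ℤP.+-identityˡ (ℤ.- d ℤ.* R j) ⟩
    ℤ.- d ℤ.* R j                                   ≡⟨ sym (sumℤ-*ˡ r (ℤ.- d) (λ k → c (Fin.suc k) ℤ.* v (Fin.suc k) j)) ⟩
    sumℤ r (λ k → ℤ.- d ℤ.* (c (Fin.suc k) ℤ.* v (Fin.suc k) j))
      ≈⟨ sumℤ-cong-≡ₚ r (λ k → ≡ₚ-reflexive (sym (ℤP.*-assoc (ℤ.- d) (c (Fin.suc k)) (v (Fin.suc k) j)))) ⟩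
    sumℤ r (λ k → ℤ.- d ℤ.* c (Fin.suc k) ℤ.* v (Fin.suc k) j) ∎
    where
    open import Relation.Binary.Reasoning.Setoid ≡ₚ-setoid
    d : ℤ
    d = proj₁ (inverseₚ (c Fin.zero) ¬p∣c₀)
    dc₀≡1 : d ℤ.* c Fin.zero ≡ₚ + 1
    dc₀≡1 = proj₂ (inverseₚ (c Fin.zero) ¬p∣c₀)
    R : Fin n → ℤ
    R j = sumℤ r (λ k → c (Fin.suc k) ℤ.* v (Fin.suc k) j)

  maximal-independentₚ⇒combination : ∀ {n r} (A : Mat n) {f : Fin r → Fin n} →
    IndependentRowsₚ p A f → ((g : Fin (suc r) → Fin n) → ¬ IndependentRowsₚ p A g) →
    ∀ x → ¬ ¬ Σ (Fin r → ℤ) λ e → ∀ j → A x j ≡ₚ sumℤ r (λ k → e k ℤ.* A (f k) j)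
  maximal-independentₚ⇒combination {r = r} A {f} ind maximal x ¬comb = maximal (x ∷ᶠ f) λ c rel →
    let p∣c₀ = decidable-stable (p ℕD.∣? ℤ.∣ c Fin.zero ∣)
                 (λ ¬p∣c₀ → ¬comb (relationₚ⇒combination (λ i j → A ((x ∷ᶠ f) i) j) c
                                     (¬p∣c₀ ∘ ℤS.∣⇒∣ᵤ) (ℤS.∣ᵤ⇒∣ ∘ rel)))
    in λ { Fin.zero    → p∣c₀
         ; (Fin.suc k) → ind (c ∘ Fin.suc) (λ j → ℤS.∣⇒∣ᵤ
             (ℤS.∣m+n∣m⇒∣n {+ p} {c Fin.zero ℤ.* A x j} (ℤS.∣ᵤ⇒∣ (rel j))
               (ℤS.∣m⇒∣m*n {+ p} {c Fin.zero} (A x j) (ℤS.∣ᵤ⇒∣ p∣c₀)))) k }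

  half : ℕ
  half = (p ∸ 1) ℕ./ 2

  half+half≤p∸1 : half + half ≤ p ∸ 1
  half+half≤p∸1 = subst (_≤ p ∸ 1) (trans (ℕP.*-comm half 2) (cong (_+_ half) (ℕP.+-identityʳ half)))
    (ℕDM.m/n*n≤m (p ∸ 1) 2)

  p≤2+half+half : p ≤ 2 + (half + half)
  p≤2+half+half = begin
    p                                   ≡⟨ sym (ℕP.suc-pred p) ⟩
    suc (p ∸ 1)                         ≡⟨ cong suc (ℕDM.m≡m%n+[m/n]*n (p ∸ 1) 2) ⟩
    suc ((p ∸ 1) ℕ.% 2 + half * 2)      ≤⟨ s≤s (ℕP.+-monoˡ-≤ (half * 2) (ℕP.≤-pred (ℕDM.m%n<n (p ∸ 1) 2))) ⟩
    2 + half * 2                        ≡⟨ cong (_+_ 2) (trans (ℕP.*-comm half 2) (cong (_+_ half) (ℕP.+-identityʳ half))) ⟩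
    2 + (half + half)                   ∎
    where open ℕP.≤-Reasoning

  -- Only possible for p = 2: two residues above half cannot add up to p otherwise.
  >half⇒≡ : ∀ {a b} → a + b ≡ p → half < a → half < b → a ≡ b
  >half⇒≡ {a} {b} a+b≡p half<a half<b = trans (≡suc-half a+b≡p half<a half<b)
    (sym (≡suc-half (trans (ℕP.+-comm b a) a+b≡p) half<b half<a))
    where
    ≡suc-half : ∀ {x y} → x + y ≡ p → half < x → half < y → x ≡ suc half
    ≡suc-half {x} {y} x+y≡p half<x half<y = ℕP.≤-antisym (ℕP.+-cancelʳ-≤ y x (suc half) (begin
      x + y                     ≡⟨ x+y≡p ⟩
      p                         ≤⟨ p≤2+half+half ⟩
      2 + (half + half)         ≡⟨ cong suc (sym (ℕP.+-suc half half)) ⟩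
      suc half + suc half       ≤⟨ ℕP.+-monoʳ-≤ (suc half) half<y ⟩
      suc half + y              ∎)) half<x
      where open ℕP.≤-Reasoning

  p∣m⇒0<m⇒m<2p⇒m≡p : ∀ {m} → p ℕD.∣ m → 0 < m → m < p + p → m ≡ p
  p∣m⇒0<m⇒m<2p⇒m≡p (ℕD.divides zero          m≡0)  0<m m<2p = ⊥-elim (ℕP.<-irrefl (sym m≡0) 0<m)
  p∣m⇒0<m⇒m<2p⇒m≡p (ℕD.divides (suc zero)    m≡p)  0<m m<2p = trans m≡p (ℕP.+-identityʳ p)
  p∣m⇒0<m⇒m<2p⇒m≡p (ℕD.divides (suc (suc q)) m≡qp) 0<m m<2p = ⊥-elim (ℕP.<⇒≱ m<2p
    (subst (p + p ≤_) (sym m≡qp) (ℕP.+-monoʳ-≤ p (ℕP.m≤m+n p (q * p)))))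

  nonzeroₚ : ℤ → ℕ
  nonzeroₚ z with + p ℤS.∣? z
  ... | yes _ = 0
  ... | no  _ = 1

  ¬∣-* : ∀ {a} x → 0 < a → a < p → ¬ + p ℤS.∣ x → ¬ + p ℤS.∣ + a ℤ.* x
  ¬∣-* {a} x 0<a a<p ¬p∣x p∣ax with ∣-*⇒∣ (+ a) x p∣ax
  ... | inj₁ p∣a = ¬∣-small 0<a a<p p∣a
  ... | inj₂ p∣x = ¬p∣x p∣x

  %ℕ-complement : ∀ {a b} x → a + b ≡ p → 0 < a → 0 < b →
    (+ a ℤ.* x) %ℕ p + (+ b ℤ.* x) %ℕ p ≡ p * nonzeroₚ x
  %ℕ-complement {a} {b} x a+b≡p 0<a 0<b with + p ℤS.∣? x
  ... | yes p∣x = trans (cong₂ _+_ (∣⇒%ℕ≡0 (ℤS.∣n⇒∣m*n (+ a) p∣x)) (∣⇒%ℕ≡0 (ℤS.∣n⇒∣m*n (+ b) p∣x)))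
                        (sym (ℕP.*-zeroʳ p))
  ... | no ¬p∣x = trans (p∣m⇒0<m⇒m<2p⇒m≡p p∣sum
                          (ℕP.<-≤-trans (¬∣⇒%ℕ>0 (¬∣-* x 0<a a<p ¬p∣x)) (ℕP.m≤m+n ((+ a ℤ.* x) %ℕ p) ((+ b ℤ.* x) %ℕ p)))
                          (ℕP.+-mono-< (ℤDM.n%ℕd<d (+ a ℤ.* x) p) (ℤDM.n%ℕd<d (+ b ℤ.* x) p)))
                        (sym (ℕP.*-identityʳ p))
    where
    a<p : a < p
    a<p = subst (a <_) a+b≡p (ℕP.m<m+n a 0<b)
    sum≡ₚ0 : + ((+ a ℤ.* x) %ℕ p + (+ b ℤ.* x) %ℕ p) ≡ₚ + 0
    sum≡ₚ0 = begin
      + ((+ a ℤ.* x) %ℕ p + (+ b ℤ.* x) %ℕ p)      ≡⟨ ℤP.pos-+ ((+ a ℤ.* x) %ℕ p) ((+ b ℤ.* x) %ℕ p) ⟩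
      + ((+ a ℤ.* x) %ℕ p) ℤ.+ + ((+ b ℤ.* x) %ℕ p) ≈⟨ +-cong-≡ₚ (≡ₚ-sym (≡ₚ-%ℕ (+ a ℤ.* x))) (≡ₚ-sym (≡ₚ-%ℕ (+ b ℤ.* x))) ⟩
      + a ℤ.* x ℤ.+ + b ℤ.* x                       ≡⟨ sym (ℤP.*-distribʳ-+ x (+ a) (+ b)) ⟩
      (+ a ℤ.+ + b) ℤ.* x                           ≡⟨ cong (ℤ._* x) (sym (ℤP.pos-+ a b) ⟨ trans ⟩ cong +_ a+b≡p) ⟩
      + p ℤ.* x                                     ≈⟨ ∣⇒≡ₚ0 (ℤS.∣m⇒∣m*n x (ℤS.∣-refl {+ p})) ⟩
      + 0                                           ∎
      where open import Relation.Binary.Reasoning.Setoid ≡ₚ-setoid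
    p∣sum : p ℕD.∣ (+ a ℤ.* x) %ℕ p + (+ b ℤ.* x) %ℕ p
    p∣sum = ℤS.∣⇒∣ᵤ (≡ₚ0⇒∣ sum≡ₚ0)

  residueVectors : ∀ r → List (Vec ℕ r)
  residueVectors zero    = V.[] ∷ []
  residueVectors (suc r) = cartesianProductWith V._∷_ (upTo p) (residueVectors r)

  tabulate∈residueVectors : ∀ {r} (g : Fin r → ℕ) → (∀ k → g k < p) → V.tabulate g ∈ residueVectors r
  tabulate∈residueVectors {zero}  g g<p = here refl
  tabulate∈residueVectors {suc r} g g<p = AnyP.cartesianProductWith⁺ V._∷_ (cong₂ V._∷_)
    (∈-upTo⁺ (g<p Fin.zero)) (tabulate∈residueVectors (g ∘ Fin.suc) (g<p ∘ Fin.suc))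

  length-residueVectors : ∀ r → length (residueVectors r) ≡ p ^ r
  length-residueVectors zero    = refl
  length-residueVectors (suc r) = trans (length-cartesianProductWith V._∷_ (upTo p) (residueVectors r))
    (cong₂ ℕ._*_ (ListP.length-upTo p) (length-residueVectors r))

  geometricSum : ℕ → ℕ
  geometricSum zero    = 0
  geometricSum (suc r) = geometricSum r + p ^ r

  spannerCount : ℕ → ℕ
  spannerCount r = suc half * geometricSum r

  [p∸1]*geometricSum≡p^r∸1 : ∀ r → (p ∸ 1) * geometricSum r ≡ p ^ r ∸ 1
  [p∸1]*geometricSum≡p^r∸1 r = trans (sym (ℕP.m+n∸n≡m ((p ∸ 1) * geometricSum r) 1)) (cong (_∸ 1) (+1≡p^r r))
    where
    open ≡-Reasoning
    q : ℕ
    q = p ∸ 1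
    +1≡p^r : ∀ r → q * geometricSum r + 1 ≡ p ^ r
    +1≡p^r zero    = cong (_+ 1) (ℕP.*-zeroʳ q)
    +1≡p^r (suc r) = begin
      q * (geometricSum r + p ^ r) + 1   ≡⟨ ℕsolve 3 (λ q G X → q :*ℕ (G :+ℕ X) :+ℕ conℕ 1 :=ℕ (q :*ℕ G :+ℕ conℕ 1) :+ℕ q :*ℕ X)
                                                   refl q (geometricSum r) (p ^ r) ⟩
      (q * geometricSum r + 1) + q * p ^ r ≡⟨ cong (_+ q * p ^ r) (+1≡p^r r) ⟩
      suc q * p ^ r                       ≡⟨ cong (_* p ^ r) (ℕP.suc-pred p) ⟩
      p * p ^ r                           ∎

  2*[p∸1]*spannerCount≤ : ∀ r → 2 * (p ∸ 1) * spannerCount r ≤ (p ^ r ∸ 1) * (p + 1)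
  2*[p∸1]*spannerCount≤ r = begin
    2 * q * (suc half * G)        ≡⟨ ℕsolve 3 (λ q h G → conℕ 2 :*ℕ q :*ℕ ((conℕ 1 :+ℕ h) :*ℕ G) :=ℕ (q :*ℕ G) :*ℕ (conℕ 2 :+ℕ (h :+ℕ h)))
                                           refl q half G ⟩
    (q * G) * (2 + (half + half)) ≤⟨ ℕP.*-monoʳ-≤ (q * G) (ℕP.+-monoʳ-≤ 2 half+half≤p∸1) ⟩
    (q * G) * (2 + q)             ≡⟨ cong₂ _*_ ([p∸1]*geometricSum≡p^r∸1 r) (cong suc (ℕP.suc-pred p) ⟨ trans ⟩ ℕP.+-comm 1 p) ⟩
    (p ^ r ∸ 1) * (p + 1)         ∎
    where
    open ℕP.≤-Reasoning
    q G : ℕ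
    q = p ∸ 1
    G = geometricSum r

module Reduction {p : ℕ} (pp : Prime p) {n : ℕ} where

  open Modulo pp

  infixr 7 _·_
  _·_ : ℕ → (Fin n → ℤ) → Fin n → ℤ
  (a · u) j = + a ℤ.* u j

  remℚ : (Fin n → ℤ) → Fin n → ℚ
  remℚ u j = toℚ (+ (u j %ℕ p))

  remℚ-cong : ∀ {u w} → (∀ j → u j ≡ₚ w j) → ∀ j → remℚ u j ≡ remℚ w j
  remℚ-cong u≡ₚw j = cong (λ m → toℚ (+ m)) (%ℕ-cong (u≡ₚw j))

  supportℚ : (Fin n → ℤ) → Fin n → ℚ
  supportℚ u j = toℚ (+ nonzeroₚ (u j))

  remℚ-complement : ∀ {a b} u j → a + b ≡ p → 0 < a → 0 < b →
    remℚ (a · u) j ℚ.+ remℚ (b · u) j ≡ toℚ (+ p) ℚ.* supportℚ u j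
  remℚ-complement {a} {b} u j a+b≡p 0<a 0<b = begin
    toℚ (+ ((a · u) j %ℕ p)) ℚ.+ toℚ (+ ((b · u) j %ℕ p)) ≡⟨ sym (toℚ-+ (+ ((a · u) j %ℕ p)) (+ ((b · u) j %ℕ p))) ⟩
    toℚ (+ ((a · u) j %ℕ p + (b · u) j %ℕ p))             ≡⟨ cong (λ m → toℚ (+ m)) (%ℕ-complement (u j) a+b≡p 0<a 0<b) ⟩
    toℚ (+ (p * nonzeroₚ (u j)))                          ≡⟨ cong toℚ (ℤP.pos-* p (nonzeroₚ (u j))) ⟩
    toℚ (+ p ℤ.* + nonzeroₚ (u j))                        ≡⟨ toℚ-* (+ p) (+ nonzeroₚ (u j)) ⟩
    toℚ (+ p) ℚ.* supportℚ u j                            ∎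
    where open ≡-Reasoning

  -- rem(a u) + rem(b u) = p · support(u) when a + b = p, so multipliers above half reduce to ones below.
  remℚ-multiple∈Span : ∀ (L : List (Fin n → ℚ)) u →
    (∀ c → 0 < c → c ≤ half → Span L (remℚ (c · u))) → Span L (supportℚ u) →
    ∀ {a b} → a + b ≡ p → 0 < a → 0 < b → Span L (remℚ (a · u))
  remℚ-multiple∈Span L u small support {a} {b} a+b≡p 0<a 0<b with a ℕP.≤? half | b ℕP.≤? half
  ... | yes a≤half | _           = small a 0<a a≤half
  ... | no  _      | yes b≤half  = Span-resp L (λ j →
        trans (cong (ℚ._+ ℚ.- 1ℚ ℚ.* remℚ (b · u) j) (sym (remℚ-complement u j a+b≡p 0<a 0<b)))
              (solve 2 (λ x y → x :+ y :+ (:- con 1ℚ) :* y := x) refl (remℚ (a · u) j) (remℚ (b · u) j)))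
        (Span-linear L (toℚ (+ p)) (ℚ.- 1ℚ) support (small b 0<b b≤half))
  ... | no  a≰half | no  b≰half  = Span-resp L (λ j → begin
        toℚ (+ p) ℚ.* ℚ.½ ℚ.* supportℚ u j ℚ.+ 0ℚ ℚ.* supportℚ u j
          ≡⟨ solve 2 (λ x s → x :* con ℚ.½ :* s :+ con 0ℚ :* s := x :* s :* con ℚ.½) refl (toℚ (+ p)) (supportℚ u j) ⟩
        toℚ (+ p) ℚ.* supportℚ u j ℚ.* ℚ.½
          ≡⟨ cong (ℚ._* ℚ.½) (sym (remℚ-complement u j a+b≡p 0<a 0<b)) ⟩
        (remℚ (a · u) j ℚ.+ remℚ (b · u) j) ℚ.* ℚ.½
          ≡⟨ cong (λ c → (remℚ (a · u) j ℚ.+ remℚ (c · u) j) ℚ.* ℚ.½) (sym a≡b) ⟩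
        (remℚ (a · u) j ℚ.+ remℚ (a · u) j) ℚ.* ℚ.½
          ≡⟨ solve 1 (λ x → (x :+ x) :* con ℚ.½ := x) refl (remℚ (a · u) j) ⟩
        remℚ (a · u) j ∎)
        (Span-linear L (toℚ (+ p) ℚ.* ℚ.½) 0ℚ support support)
    where
    open ≡-Reasoning
    a≡b : a ≡ b
    a≡b = >half⇒≡ a+b≡p (ℕP.≰⇒> a≰half) (ℕP.≰⇒> b≰half)

  monic : ∀ {r} → (Fin n → ℤ) → (Fin r → Fin n → ℤ) → Vec ℕ r → Fin n → ℤ
  monic {r} b₀ b v j = b₀ j ℤ.+ sumℤ r (λ k → + V.lookup v k ℤ.* b k j)

  leadingSpanners : ∀ {r} → (Fin n → ℤ) → (Fin r → Fin n → ℤ) → List (Fin n → ℚ)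
  leadingSpanners {r} b₀ b =
    cartesianProductWith (λ c v → remℚ (suc c · monic b₀ b v)) (upTo half) (residueVectors r)
    ++ map (λ v → supportℚ (monic b₀ b v)) (residueVectors r)

  remSpanners : ∀ r → (Fin r → Fin n → ℤ) → List (Fin n → ℚ)
  remSpanners zero    b = []
  remSpanners (suc r) b = remSpanners r (b ∘ Fin.suc) ++ leadingSpanners (b Fin.zero) (b ∘ Fin.suc)

  remℚ-monic∈Span : ∀ {r} b₀ (b : Fin r → Fin n → ℤ) {v} → v ∈ residueVectors r →
    ∀ a → 0 < a → a < p → Span (leadingSpanners b₀ b) (remℚ (a · monic b₀ b v))
  remℚ-monic∈Span {r} b₀ b {v} v∈ a 0<a a<p = remℚ-multiple∈Span (leadingSpanners b₀ b) (monic b₀ b v)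
    (λ { (suc c) _ c<half → Span-∈ (leadingSpanners b₀ b)
           (AnyP.++⁺ˡ (AnyP.cartesianProductWith⁺ F (cong₂ F) (∈-upTo⁺ c<half) v∈)) })
    (Span-∈ (leadingSpanners b₀ b) (AnyP.++⁺ʳ (cartesianProductWith F (upTo half) (residueVectors r))
      (∈-map⁺ (λ v → supportℚ (monic b₀ b v)) v∈)))
    (ℕP.m+[n∸m]≡n (ℕP.<⇒≤ a<p)) 0<a (ℕP.m<n⇒0<n∸m a<p)
    where
    F : ℕ → Vec ℕ r → Fin n → ℚ
    F c v = remℚ (suc c · monic b₀ b v)

  record MonicForm {r} (b : Fin (suc r) → Fin n → ℤ) (e : Fin (suc r) → ℤ) : Set where
    field
      coefficients   : Vec ℕ r
      coefficients∈  : coefficients ∈ residueVectors r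
      scale          : ℕ
      0<scale        : 0 < scale
      scale<p        : scale < p
      combination≡ₚ  : ∀ j → sumℤ (suc r) (λ k → e k ℤ.* b k j)
                               ≡ₚ (scale · monic (b Fin.zero) (b ∘ Fin.suc) coefficients) j

  -- Dividing by the unit e₀ and reducing the other coefficients mod p.
  unit-leading⇒monicForm : ∀ {r} (b : Fin (suc r) → Fin n → ℤ) (e : Fin (suc r) → ℤ) → ¬ + p ℤS.∣ e Fin.zero →
    MonicForm b e
  unit-leading⇒monicForm {r} b e ¬p∣e₀ = record
    { coefficients  = v
    ; coefficients∈ = tabulate∈residueVectors g (λ k → ℤDM.n%ℕd<d (d ℤ.* e (Fin.suc k)) p)
    ; scale         = a
    ; 0<scale       = ¬∣⇒%ℕ>0 ¬p∣e₀
    ; scale<p       = ℤDM.n%ℕd<d e₀ p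
    ; combination≡ₚ = combination≡ₚ
    }
    where
    e₀ d : ℤ
    e₀ = e Fin.zero
    d = proj₁ (inverseₚ e₀ ¬p∣e₀)
    a : ℕ
    a = e₀ %ℕ p
    g : Fin r → ℕ
    g k = (d ℤ.* e (Fin.suc k)) %ℕ p
    v : Vec ℕ r
    v = V.tabulate g
    open import Relation.Binary.Reasoning.Setoid ≡ₚ-setoid
    term : ∀ k j → e (Fin.suc k) ℤ.* b (Fin.suc k) j ≡ₚ + a ℤ.* (+ V.lookup v k ℤ.* b (Fin.suc k) j)
    term k j = begin
      eₖ ℤ.* B                           ≡⟨ sym (ℤP.*-identityˡ (eₖ ℤ.* B)) ⟩
      + 1 ℤ.* (eₖ ℤ.* B)                 ≈⟨ *-cong-≡ₚ (≡ₚ-sym (proj₂ (inverseₚ e₀ ¬p∣e₀))) (≡ₚ-reflexive refl) ⟩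
      (d ℤ.* e₀) ℤ.* (eₖ ℤ.* B)
        ≡⟨ ℤsolve 4 (λ d e₀ eₖ B → (d :*ℤ e₀) :*ℤ (eₖ :*ℤ B) :=ℤ e₀ :*ℤ ((d :*ℤ eₖ) :*ℤ B)) refl d e₀ eₖ B ⟩
      e₀ ℤ.* ((d ℤ.* eₖ) ℤ.* B)          ≈⟨ *-cong-≡ₚ (≡ₚ-%ℕ e₀) (*-cong-≡ₚ (≡ₚ-%ℕ (d ℤ.* eₖ)) (≡ₚ-reflexive refl)) ⟩
      + a ℤ.* (+ g k ℤ.* B)              ≡⟨ cong (λ m → + a ℤ.* (+ m ℤ.* B)) (sym (VecP.lookup∘tabulate g k)) ⟩
      + a ℤ.* (+ V.lookup v k ℤ.* B)     ∎
      where
      eₖ B : ℤ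
      eₖ = e (Fin.suc k)
      B = b (Fin.suc k) j
    combination≡ₚ : ∀ j → sumℤ (suc r) (λ k → e k ℤ.* b k j) ≡ₚ (a · monic (b Fin.zero) (b ∘ Fin.suc) v) j
    combination≡ₚ j = begin
      e₀ ℤ.* b Fin.zero j ℤ.+ sumℤ r (λ k → e (Fin.suc k) ℤ.* b (Fin.suc k) j)
        ≈⟨ +-cong-≡ₚ (*-cong-≡ₚ (≡ₚ-%ℕ e₀) (≡ₚ-reflexive refl)) (sumℤ-cong-≡ₚ r (λ k → term k j)) ⟩
      + a ℤ.* b Fin.zero j ℤ.+ sumℤ r (λ k → + a ℤ.* (+ V.lookup v k ℤ.* b (Fin.suc k) j))
        ≡⟨ cong (ℤ._+_ (+ a ℤ.* b Fin.zero j)) (sumℤ-*ˡ r (+ a) rest) ⟩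
      + a ℤ.* b Fin.zero j ℤ.+ + a ℤ.* sumℤ r rest
        ≡⟨ sym (ℤP.*-distribˡ-+ (+ a) (b Fin.zero j) (sumℤ r rest)) ⟩
      (a · monic (b Fin.zero) (b ∘ Fin.suc) v) j ∎
      where
      rest : Fin r → ℤ
      rest k = + V.lookup v k ℤ.* b (Fin.suc k) j

  remℚ-combination∈Span : ∀ r (b : Fin r → Fin n → ℤ) (e : Fin r → ℤ) →
    Span (remSpanners r b) (remℚ (λ j → sumℤ r (λ k → e k ℤ.* b k j)))
  remℚ-combination∈Span zero    b e = Span-zero [] (λ j → cong (λ m → toℚ (+ m)) (ℕDM.m*n%n≡0 0 p))
  remℚ-combination∈Span (suc r) b e with + p ℤS.∣? e Fin.zero
  ... | yes p∣e₀ = Span-++⁺ˡ (remSpanners r (b ∘ Fin.suc)) (leadingSpanners (b Fin.zero) (b ∘ Fin.suc))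
    (Span-resp (remSpanners r (b ∘ Fin.suc)) (remℚ-cong (≡ₚ-sym ∘ drop-leading))
      (remℚ-combination∈Span r (b ∘ Fin.suc) (e ∘ Fin.suc)))
    where
    drop-leading : ∀ j → sumℤ (suc r) (λ k → e k ℤ.* b k j) ≡ₚ sumℤ r (λ k → e (Fin.suc k) ℤ.* b (Fin.suc k) j)
    drop-leading j = ≡ₚ-trans (+-cong-≡ₚ (∣⇒≡ₚ0 (ℤS.∣m⇒∣m*n (b Fin.zero j) p∣e₀)) (≡ₚ-reflexive refl))
                              (≡ₚ-reflexive (ℤP.+-identityˡ (sumℤ r (λ k → e (Fin.suc k) ℤ.* b (Fin.suc k) j))))
  ... | no ¬p∣e₀ = Span-++⁺ʳ (remSpanners r (b ∘ Fin.suc)) (leadingSpanners (b Fin.zero) (b ∘ Fin.suc))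
    (Span-resp (leadingSpanners (b Fin.zero) (b ∘ Fin.suc)) (remℚ-cong (≡ₚ-sym ∘ combination≡ₚ))
      (remℚ-monic∈Span (b Fin.zero) (b ∘ Fin.suc) coefficients∈ scale 0<scale scale<p))
    where open MonicForm (unit-leading⇒monicForm b e ¬p∣e₀)

  length-leadingSpanners : ∀ {r} b₀ (b : Fin r → Fin n → ℤ) → length (leadingSpanners b₀ b) ≡ suc half * p ^ r
  length-leadingSpanners {r} b₀ b = begin
    length (leadingSpanners b₀ b)
      ≡⟨ ListP.length-++ (cartesianProductWith F (upTo half) (residueVectors r)) ⟩
    length (cartesianProductWith F (upTo half) (residueVectors r)) + length (map G (residueVectors r))
      ≡⟨ cong₂ _+_ (trans (length-cartesianProductWith F (upTo half) (residueVectors r))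
                          (cong₂ _*_ (ListP.length-upTo half) (length-residueVectors r)))
                   (trans (ListP.length-map G (residueVectors r)) (length-residueVectors r)) ⟩
    half * p ^ r + p ^ r ≡⟨ ℕP.+-comm (half * p ^ r) (p ^ r) ⟩
    suc half * p ^ r     ∎
    where
    open ≡-Reasoning
    F : ℕ → Vec ℕ r → Fin n → ℚ
    F c v = remℚ (suc c · monic b₀ b v)
    G : Vec ℕ r → Fin n → ℚ
    G v = supportℚ (monic b₀ b v)

  length-remSpanners : ∀ r (b : Fin r → Fin n → ℤ) → length (remSpanners r b) ≡ spannerCount r
  length-remSpanners zero    b = sym (ℕP.*-zeroʳ (suc half))
  length-remSpanners (suc r) b = begin
    length (remSpanners (suc r) b)
      ≡⟨ ListP.length-++ (remSpanners r (b ∘ Fin.suc)) ⟩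
    length (remSpanners r (b ∘ Fin.suc)) + length (leadingSpanners (b Fin.zero) (b ∘ Fin.suc))
      ≡⟨ cong₂ _+_ (length-remSpanners r (b ∘ Fin.suc)) (length-leadingSpanners (b Fin.zero) (b ∘ Fin.suc)) ⟩
    suc half * geometricSum r + suc half * p ^ r
      ≡⟨ sym (ℕP.*-distribˡ-+ (suc half) (geometricSum r) (p ^ r)) ⟩
    suc half * geometricSum (suc r) ∎
    where open ≡-Reasoning

  remℚ-row∈¬¬Span : ∀ (A : Mat n) {r} {f : Fin r → Fin n} →
    IndependentRowsₚ p A f → ((g : Fin (suc r) → Fin n) → ¬ IndependentRowsₚ p A g) →
    ∀ x → ¬ ¬ Span (remSpanners r (A ∘ f)) (remℚ (A x))
  remℚ-row∈¬¬Span A {r} {f} ind maximal x = ¬¬-map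
    (λ { (e , A≡ₚe) → Span-resp (remSpanners r (A ∘ f)) (remℚ-cong (≡ₚ-sym ∘ A≡ₚe)) (remℚ-combination∈Span r (A ∘ f) e) })
    (maximal-independentₚ⇒combination A ind maximal x)

  instance
    toℚp-nonZero : ℚ.NonZero (toℚ (+ p))
    toℚp-nonZero = ℚ.≢-nonZero (λ p≡0 → ℕ.≢-nonZero⁻¹ p (ℤP.+-injective (toℚ-injective p≡0)))

  toℚ-/ℕ : ∀ z → toℚ (z /ℕ p) ≡ ℚ.1/ toℚ (+ p) ℚ.* toℚ z ℚ.+ ℚ.- ℚ.1/ toℚ (+ p) ℚ.* toℚ (+ (z %ℕ p))
  toℚ-/ℕ z = sym (begin
    p⁻¹ ℚ.* toℚ z ℚ.+ ℚ.- p⁻¹ ℚ.* R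
      ≡⟨ cong (λ y → p⁻¹ ℚ.* toℚ y ℚ.+ ℚ.- p⁻¹ ℚ.* R) (ℤDM.a≡a%ℕn+[a/ℕn]*n z p) ⟩
    p⁻¹ ℚ.* toℚ (+ (z %ℕ p) ℤ.+ (z /ℕ p) ℤ.* + p) ℚ.+ ℚ.- p⁻¹ ℚ.* R
      ≡⟨ cong (λ y → p⁻¹ ℚ.* y ℚ.+ ℚ.- p⁻¹ ℚ.* R) (trans (toℚ-+ (+ (z %ℕ p)) ((z /ℕ p) ℤ.* + p)) (cong (R ℚ.+_) (toℚ-* (z /ℕ p) (+ p)))) ⟩
    p⁻¹ ℚ.* (R ℚ.+ Q ℚ.* toℚ (+ p)) ℚ.+ ℚ.- p⁻¹ ℚ.* R
      ≡⟨ solve 4 (λ i R Q P → i :* (R :+ Q :* P) :+ (:- i) :* R := Q :* (P :* i)) refl p⁻¹ R Q (toℚ (+ p)) ⟩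
    Q ℚ.* (toℚ (+ p) ℚ.* p⁻¹)
      ≡⟨ cong (Q ℚ.*_) (ℚP.*-inverseʳ (toℚ (+ p))) ⟩
    Q ℚ.* 1ℚ
      ≡⟨ ℚP.*-identityʳ Q ⟩
    Q ∎)
    where
    open ≡-Reasoning
    p⁻¹ R Q : ℚ
    p⁻¹ = ℚ.1/ toℚ (+ p)
    R = toℚ (+ (z %ℕ p))
    Q = toℚ (z /ℕ p)

  quoℚ-row∈¬¬Span : ∀ (A : Mat n) {r r₀} {f : Fin r → Fin n} {fₚ : Fin r₀ → Fin n} →
    IndependentRowsℚ A f → ((g : Fin (suc r) → Fin n) → ¬ IndependentRowsℚ A g) →
    IndependentRowsₚ p A fₚ → ((g : Fin (suc r₀) → Fin n) → ¬ IndependentRowsₚ p A g) →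
    ∀ x → ¬ ¬ Span (tabulate (λ k j → toℚ (A (f k) j)) ++ remSpanners r₀ (A ∘ fₚ)) (λ j → toℚ (quoM pp A x j))
  quoℚ-row∈¬¬Span A {r} {r₀} {f} {fₚ} ind maximal indₚ maximalₚ x ¬span =
    maximal-independent⇒combination A ind maximal x λ { (α , A≡α) →
    remℚ-row∈¬¬Span A indₚ maximalₚ x λ rem∈ →
    ¬span (Span-resp L (λ j → sym (toℚ-/ℕ (A x j)))
      (Span-linear L (ℚ.1/ toℚ (+ p)) (ℚ.- ℚ.1/ toℚ (+ p))
        (Span-++⁺ˡ rows (remSpanners r₀ (A ∘ fₚ)) (Span-tabulate (λ k j → toℚ (A (f k) j)) α A≡α))
        (Span-++⁺ʳ rows (remSpanners r₀ (A ∘ fₚ)) rem∈))) }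
    where
    rows L : List (Fin n → ℚ)
    rows = tabulate (λ k j → toℚ (A (f k) j))
    L = rows ++ remSpanners r₀ (A ∘ fₚ)

  rank[rem]≤spannerCount : ∀ (A : Mat n) {r₀ s} → IsRankₚ p A r₀ → IsRank (remM pp A) s → s ≤ spannerCount r₀
  rank[rem]≤spannerCount A {r₀} {s} ((fₚ , indₚ) , maximalₚ) ((g , ind) , _) =
    subst (s ≤_) (length-remSpanners r₀ (A ∘ fₚ))
      (independent-in-¬¬Span⇒≤length (remSpanners r₀ (A ∘ fₚ)) (λ i → remℚ (A (g i)))
        (λ i → remℚ-row∈¬¬Span A indₚ maximalₚ (g i)) ind)

  rank[quo]≤rank+spannerCount : ∀ (A : Mat n) {r r₀ t} → IsRank A r → IsRankₚ p A r₀ → IsRank (quoM pp A) t →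
    t ≤ r + spannerCount r₀
  rank[quo]≤rank+spannerCount A {r} {r₀} {t} ((f , ind) , maximal) ((fₚ , indₚ) , maximalₚ) ((g , ind-quo) , _) =
    subst (t ≤_) length≡
      (independent-in-¬¬Span⇒≤length (rows ++ remSpanners r₀ (A ∘ fₚ)) (λ i j → toℚ (quoM pp A (g i) j))
        (λ i → quoℚ-row∈¬¬Span A ind maximal indₚ maximalₚ (g i)) ind-quo)
    where
    rows : List (Fin n → ℚ)
    rows = tabulate (λ k j → toℚ (A (f k) j))
    length≡ : length (rows ++ remSpanners r₀ (A ∘ fₚ)) ≡ r + spannerCount r₀
    length≡ = trans (ListP.length-++ rows)
      (cong₂ _+_ (ListP.length-tabulate (λ k j → toℚ (A (f k) j))) (length-remSpanners r₀ (A ∘ fₚ)))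

theorem1 : (p n : ℕ) (pp : Prime p) (A : Mat n) (r r₀ : ℕ) →
    IsRank A r → IsRankₚ p A r₀ → p ^ r₀ < n →
    ((s : ℕ) → IsRank (remM pp A) s →
      2 * (p ∸ 1) * s ≤ (p ^ r₀ ∸ 1) * (p + 1)) ×
    ((t : ℕ) → IsRank (quoM pp A) t →
      2 * (p ∸ 1) * t ≤ 2 * (p ∸ 1) * r + (p ^ r₀ ∸ 1) * (p + 1))
theorem1 p n pp A r r₀ rank rankₚ _ = rem-bound , quo-bound
  where
  open Modulo pp
  open Reduction pp {n}
  rem-bound : (s : ℕ) → IsRank (remM pp A) s → 2 * (p ∸ 1) * s ≤ (p ^ r₀ ∸ 1) * (p + 1)
  rem-bound s rank-rem = ℕP.≤-trans (ℕP.*-monoʳ-≤ (2 * (p ∸ 1)) (rank[rem]≤spannerCount A rankₚ rank-rem))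
                                    (2*[p∸1]*spannerCount≤ r₀)
  quo-bound : (t : ℕ) → IsRank (quoM pp A) t → 2 * (p ∸ 1) * t ≤ 2 * (p ∸ 1) * r + (p ^ r₀ ∸ 1) * (p + 1)
  quo-bound t rank-quo = begin
    2 * (p ∸ 1) * t                                 ≤⟨ ℕP.*-monoʳ-≤ (2 * (p ∸ 1)) (rank[quo]≤rank+spannerCount A rank rankₚ rank-quo) ⟩
    2 * (p ∸ 1) * (r + spannerCount r₀)             ≡⟨ ℕP.*-distribˡ-+ (2 * (p ∸ 1)) r (spannerCount r₀) ⟩
    2 * (p ∸ 1) * r + 2 * (p ∸ 1) * spannerCount r₀ ≤⟨ ℕP.+-monoʳ-≤ (2 * (p ∸ 1) * r) (2*[p∸1]*spannerCount≤ r₀) ⟩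
    2 * (p ∸ 1) * r + (p ^ r₀ ∸ 1) * (p + 1)        ∎
    where open ℕP.≤-Reasoning
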